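{- Let $n,a,b$ be positive integers with $a+b<n$ and $b>\frac n2$. (a) For every integer $i$ with $0\le i\le 2b-n$, the set $\mathcal F_i(n,a,b)$ is a maximal independent set of $\Gamma(n,\{a,b\})$. (b) For $i=2b-n+1$, the set $\bar{\mathcal F}_i(n,a,b)$ is a maximal independent set of $\Gamma(n,\{a,b\})$, and it is the only maximal independent set containing $\mathcal F_i(n,a,b)$. Moreover $|\bar{\mathcal F}_i(n,a,b)\setminus\mathcal F_i(n,a,b)|=\binom{2s-2}{s-2}\binom{s-1}{a}$, where $s=n-b$.
   Context: $[n]=\{1,\dots,n\}$, $[0]=\emptyset$. Subsets $X,Y$ of $[n]$ are in general position if $X\cup Y=[n]$ or $X\cap Y=\emptyset$. The vertices of $\Gamma(n,\{a,b\})$ (for $a<b$) are the pairs $(A,B)$ with $A\subseteq B\subseteq[n]$, $|A|=a$, $|B|=b$ (flags of type $\{a,b\}$); $(A,B)$ and $(A',B')$ are adjacent iff each of $A,B$ is in general position with each of $A',B'$. For positive integers $n,a,b$ with $a<\frac n2<b$, $a+b<n$ and an integer $0\le i\le 2b-n+1$, $\mathcal F_i(n,a,b)$ is the set of vertices $(A,B)$ satisfying at least one of (I) $[i]\subseteq B\subseteq[n-1]$, (II) $\min A\le i$ and $[\min A]\subseteq B$. For $i=2b-n+1$, $\bar{\mathcal F}_i(n,a,b)$ is the set of vertices $(A,B)$ satisfying $[i]\subseteq B$ or (II). -}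

module Defs where

open import Data.Nat using (ℕ; suc; _≤_; _∸_)
open import Data.Fin using (Fin; toℕ)
open import Data.Fin.Subset using (Subset; _∈_; _∪_; _∩_; ∣_∣) renaming (⊤ to full; ⊥ to empty; _⊆_ to _⊆ₛ_)
open import Data.Product using (Σ; _×_; ∃)
open import Data.Sum using (_⊎_)
open import Relation.Nullary using (¬_)
open import Relation.Binary.PropositionalEquality using (_≡_)

-- Convention: element x : Fin n of a subset of [n] represents the number val x = toℕ x + 1.
val : {n : ℕ} → Fin n → ℕ
val x = suc (toℕ x)

Vtx : ℕ → Set
Vtx n = Subset n × Subset n

IsVertex : (n a b : ℕ) → Vtx n → Set
IsVertex n a b (A Data.Product., B) = A ⊆ₛ B × ∣ A ∣ ≡ a × ∣ B ∣ ≡ b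

GenPos : {n : ℕ} → Subset n → Subset n → Set
GenPos X Y = (X ∪ Y ≡ full) ⊎ (X ∩ Y ≡ empty)

Adj : {n : ℕ} → Vtx n → Vtx n → Set
Adj (A Data.Product., B) (A' Data.Product., B') =
  GenPos A A' × GenPos A B' × GenPos B A' × GenPos B B'

VSet : ℕ → Set₁
VSet n = Vtx n → Set

_⊆ᵥ_ : {n : ℕ} → VSet n → VSet n → Set
S ⊆ᵥ T = ∀ v → S v → T v

Independent : (n a b : ℕ) → VSet n → Set
Independent n a b S = (∀ v → S v → IsVertex n a b v) × (∀ v w → S v → S w → ¬ Adj v w)

MaximalIndependent : (n a b : ℕ) → VSet n → Set₁
MaximalIndependent n a b S =
  Independent n a b S × (∀ (T : VSet n) → Independent n a b T → S ⊆ᵥ T → T ⊆ᵥ S)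

InitialIn : {n : ℕ} → ℕ → Subset n → Set
InitialIn k B = ∀ x → val x ≤ k → x ∈ B

IsMin : {n : ℕ} → Fin n → Subset n → Set
IsMin x A = x ∈ A × (∀ y → y ∈ A → val x ≤ val y)

CondI : (n i : ℕ) → Vtx n → Set
CondI n i (A Data.Product., B) = InitialIn i B × (∀ x → x ∈ B → val x ≤ n ∸ 1)

CondII : (n i : ℕ) → Vtx n → Set
CondII n i (A Data.Product., B) = ∃ λ x → IsMin x A × val x ≤ i × InitialIn (val x) B

𝓕 : (n a b i : ℕ) → VSet n
𝓕 n a b i v = IsVertex n a b v × (CondI n i v ⊎ CondII n i v)

𝓕̄ : (n a b i : ℕ) → VSet n
𝓕̄ n a b i v = IsVertex n a b v × (InitialIn i (Data.Product.proj₂ v) ⊎ CondII n i v)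

-- For flags of type {a, b} with a + b < n < 2b, the sizes force adjacency of (A , B) and (A′ , B′)
-- to mean A ∩ B′ = A′ ∩ B = ∅ and B ∪ B′ = [n]; in particular B ∩ B′ has exactly 2b − n elements.
-- Independence: two flags satisfying (I) cannot both miss n; if one satisfies (II), the smaller of
-- the two minima of the a-sets lies in the other b-set; and for i = 2b − n + 1 two b-sets
-- containing [i] would meet in more than 2b − n points.
-- Maximality: a flag outside the family either misses from B some x ≤ i with x ≤ min A, or
-- contains [i] with min A > i (and then, outside 𝓕ᵢ, also contains n). In the first case the least
-- p ∉ B becomes the minimum of the a-set of an adjacent flag satisfying (II); in the second an
-- adjacent flag satisfying (I) is obtained by putting A and n into the complement of its b-set.
-- Counting: 𝓕̄ᵢ ∖ 𝓕ᵢ consists of the flags with [i] ⊆ B, n ∈ B and min A > i, so ∁ B is an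
-- s-subset of {i + 1, …, n − 1} and A an a-subset of the s − 1 remaining elements above i.

module Submission where

open import Defs
open import Data.Nat using (ℕ; zero; suc; _+_; _*_; _∸_; _≤_; _<_; z≤n; s≤s; _≤?_; _≟_)
open import Data.Nat.Properties
open import Data.Nat.Combinatorics using (_C_; nCk≡nC[n∸k]; nCk+nC[k+1]≡[n+1]C[k+1])
open import Data.Bool.Properties using (not-involutive)
open import Data.Fin using (Fin; zero; suc; toℕ; fromℕ)
open import Data.Fin.Properties using (toℕ-fromℕ; toℕ-injective; all?; any?; ¬∀⟶∃¬)
open import Data.Fin.Subset
  using (Subset; inside; outside; ⊥; ⊤; ⁅_⁆; ∁; _∪_; _∩_; _─_; ∣_∣; Nonempty)
  renaming (_∈_ to _∈ₛ_; _∉_ to _∉ₛ_; _⊆_ to _⊆ₛ_)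
open import Data.Fin.Subset.Properties
open import Data.Vec using ([]; _∷_; here; there)
open import Data.Vec.Properties using (∷-injectiveʳ)
open import Data.List using (List; []; _∷_; map; _++_; concatMap; length)
open import Data.List.Properties using (length-map; length-++)
open import Data.List.Membership.Propositional using (_∈_; find; lose)
open import Data.List.Membership.Propositional.Properties
  using (∈-map⁺; ∈-map⁻; ∈-++⁺ˡ; ∈-++⁺ʳ; ∈-++⁻; ∈-concatMap⁺; ∈-concatMap⁻)
open import Data.List.Relation.Unary.Any using (here; there)
import Data.List.Relation.Unary.All as All
open import Data.List.Relation.Unary.All using ([])
open import Data.List.Relation.Unary.AllPairs using ([]; _∷_)
open import Data.List.Relation.Unary.Unique.Propositional using (Unique)
import Data.List.Relation.Unary.Unique.Propositional.Properties as Unique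
open import Data.Product using (Σ; _×_; _,_; proj₁; proj₂; ∃; ∃₂)
open import Data.Sum using (_⊎_; inj₁; inj₂; [_,_]; map₁; swap)
open import Function using (id; _∘_)
open import Function.Bundles using (_⇔_; mk⇔)
open import Relation.Nullary using (¬_; Dec; yes; no; contradiction; _→-dec_; _×-dec_; _⊎-dec_)
open import Relation.Binary.PropositionalEquality hiding ([_])
open import Data.Nat.Tactic.RingSolver using (solve-∀)

private
  variable
    m k i : ℕ
    p q : Subset m
    x : Fin m

-- Subsets of [m]

∣p∪q∣+∣p∩q∣≡∣p∣+∣q∣ : (p q : Subset m) → ∣ p ∪ q ∣ + ∣ p ∩ q ∣ ≡ ∣ p ∣ + ∣ q ∣
∣p∪q∣+∣p∩q∣≡∣p∣+∣q∣ []            []            = refl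
∣p∪q∣+∣p∩q∣≡∣p∣+∣q∣ (inside ∷ p)  (inside ∷ q)  = cong suc (begin
  ∣ p ∪ q ∣ + suc ∣ p ∩ q ∣  ≡⟨ +-suc _ _ ⟩
  suc (∣ p ∪ q ∣ + ∣ p ∩ q ∣) ≡⟨ cong suc (∣p∪q∣+∣p∩q∣≡∣p∣+∣q∣ p q) ⟩
  suc (∣ p ∣ + ∣ q ∣)        ≡⟨ +-suc _ _ ⟨
  ∣ p ∣ + suc ∣ q ∣          ∎)
  where open ≡-Reasoning
∣p∪q∣+∣p∩q∣≡∣p∣+∣q∣ (inside ∷ p)  (outside ∷ q) = cong suc (∣p∪q∣+∣p∩q∣≡∣p∣+∣q∣ p q)
∣p∪q∣+∣p∩q∣≡∣p∣+∣q∣ (outside ∷ p) (inside ∷ q)  =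
  trans (cong suc (∣p∪q∣+∣p∩q∣≡∣p∣+∣q∣ p q)) (sym (+-suc _ _))
∣p∪q∣+∣p∩q∣≡∣p∣+∣q∣ (outside ∷ p) (outside ∷ q) = ∣p∪q∣+∣p∩q∣≡∣p∣+∣q∣ p q

∣p∪q∣≤∣p∣+∣q∣ : (p q : Subset m) → ∣ p ∪ q ∣ ≤ ∣ p ∣ + ∣ q ∣
∣p∪q∣≤∣p∣+∣q∣ p q = subst (∣ p ∪ q ∣ ≤_) (∣p∪q∣+∣p∩q∣≡∣p∣+∣q∣ p q) (m≤m+n _ _)

∣p─q∣+∣q∣≡∣p∣ : (p q : Subset m) → q ⊆ₛ p → ∣ p ─ q ∣ + ∣ q ∣ ≡ ∣ p ∣
∣p─q∣+∣q∣≡∣p∣ []            []            _   = refl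
∣p─q∣+∣q∣≡∣p∣ (inside ∷ p)  (inside ∷ q)  q⊆p =
  trans (+-suc _ _) (cong suc (∣p─q∣+∣q∣≡∣p∣ p q (drop-∷-⊆ q⊆p)))
∣p─q∣+∣q∣≡∣p∣ (outside ∷ p) (inside ∷ q)  q⊆p = contradiction (q⊆p here) λ ()
∣p─q∣+∣q∣≡∣p∣ (inside ∷ p)  (outside ∷ q) q⊆p = cong suc (∣p─q∣+∣q∣≡∣p∣ p q (drop-∷-⊆ q⊆p))
∣p─q∣+∣q∣≡∣p∣ (outside ∷ p) (outside ∷ q) q⊆p = ∣p─q∣+∣q∣≡∣p∣ p q (drop-∷-⊆ q⊆p)

x∈p─q⇒x∉q : (p q : Subset m) → x ∈ₛ p ─ q → x ∉ₛ q
x∈p─q⇒x∉q (_ ∷ p) (outside ∷ q) here        ()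
x∈p─q⇒x∉q (_ ∷ p) (_ ∷ q)       (there x∈)  (there x∈q) = x∈p─q⇒x∉q p q x∈ x∈q

∁-involutive : (p : Subset m) → ∁ (∁ p) ≡ p
∁-involutive []      = refl
∁-involutive (s ∷ p) = cong₂ _∷_ (not-involutive s) (∁-involutive p)

∁-injective : {p q : Subset m} → ∁ p ≡ ∁ q → p ≡ q
∁-injective {p = p} {q} ∁p≡∁q = trans (sym (∁-involutive p)) (trans (cong ∁ ∁p≡∁q) (∁-involutive q))

disjoint⇒∩≡⊥ : (∀ {x} → x ∈ₛ p → x ∉ₛ q) → p ∩ q ≡ ⊥
disjoint⇒∩≡⊥ {p = p} {q = q} p#q =
  Empty-unique λ (x , x∈p∩q) → let x∈p , x∈q = x∈p∩q⁻ p q x∈p∩q in p#q x∈p x∈q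

∩≡⊥⇒disjoint : p ∩ q ≡ ⊥ → x ∈ₛ p → x ∉ₛ q
∩≡⊥⇒disjoint p∩q≡⊥ x∈p x∈q = ∉⊥ (subst (_ ∈ₛ_) p∩q≡⊥ (x∈p∩q⁺ (x∈p , x∈q)))

covering⇒∪≡⊤ : (∀ x → x ∈ₛ p ⊎ x ∈ₛ q) → p ∪ q ≡ ⊤
covering⇒∪≡⊤ cover = ⊆-antisym ⊆⊤ λ {x} _ → x∈p∪q⁺ (cover x)

∪≡⊤⇒covering : p ∪ q ≡ ⊤ → ∀ x → x ∈ₛ p ⊎ x ∈ₛ q
∪≡⊤⇒covering {p = p} {q = q} p∪q≡⊤ x = x∈p∪q⁻ p q (subst (x ∈ₛ_) (sym p∪q≡⊤) ∈⊤)

1≤∣p∣⇒Nonempty : (p : Subset m) → 1 ≤ ∣ p ∣ → Nonempty p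
1≤∣p∣⇒Nonempty {m} p 1≤∣p∣ with nonempty? p
... | yes ne = ne
... | no ¬ne = contradiction (subst (1 ≤_) (trans (cong ∣_∣ (Empty-unique ¬ne)) (∣⊥∣≡0 m)) 1≤∣p∣) λ ()

minimum : (p : Subset m) → Nonempty p → ∃ λ x → IsMin x p
minimum (inside ∷ p)  _                 = zero , here , λ _ _ → s≤s z≤n
minimum (outside ∷ p) (suc y , there y∈p) with minimum p (y , y∈p)
... | x , x∈p , x-min = suc x , there x∈p , λ { (suc z) (there z∈p) → s≤s (x-min z z∈p) }

between : (p q : Subset m) → p ⊆ₛ q → ∣ p ∣ ≤ k → k ≤ ∣ q ∣ →
          ∃ λ r → p ⊆ₛ r × r ⊆ₛ q × ∣ r ∣ ≡ k
between []            []            _   _          z≤n = [] , id , id , refl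
between (inside ∷ p)  (outside ∷ q) p⊆q _          _   = contradiction (p⊆q here) λ ()
between (inside ∷ p)  (inside ∷ q)  p⊆q (s≤s ∣p∣≤k) (s≤s k≤∣q∣)
  with between p q (drop-∷-⊆ p⊆q) ∣p∣≤k k≤∣q∣
... | r , p⊆r , r⊆q , ∣r∣≡k = inside ∷ r , in⊆in p⊆r , in⊆in r⊆q , cong suc ∣r∣≡k
between (outside ∷ p) (outside ∷ q) p⊆q ∣p∣≤k k≤∣q∣
  with between p q (drop-∷-⊆ p⊆q) ∣p∣≤k k≤∣q∣
... | r , p⊆r , r⊆q , ∣r∣≡k = outside ∷ r , out⊆ p⊆r , out⊆ r⊆q , ∣r∣≡k
between {k = k} (outside ∷ p) (inside ∷ q) p⊆q ∣p∣≤k k≤1+∣q∣ with k ≤? ∣ q ∣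
... | yes k≤∣q∣ with between p q (drop-∷-⊆ p⊆q) ∣p∣≤k k≤∣q∣
...   | r , p⊆r , r⊆q , ∣r∣≡k = outside ∷ r , out⊆ p⊆r , out⊆ r⊆q , ∣r∣≡k
between (outside ∷ p) (inside ∷ q) p⊆q _ k≤1+∣q∣ | no k≰∣q∣ =
  inside ∷ q , out⊆ (drop-∷-⊆ p⊆q) , ⊆-refl , ≤-antisym (≰⇒> k≰∣q∣) k≤1+∣q∣

initial : ℕ → Subset m
initial {zero}  _       = []
initial {suc m} zero    = outside ∷ initial zero
initial {suc m} (suc k) = inside ∷ initial k

∈-initial⁺ : val x ≤ k → x ∈ₛ initial k
∈-initial⁺ {x = zero}  {k = suc k} _           = here
∈-initial⁺ {x = suc x} {k = suc k} (s≤s x≤k) = there (∈-initial⁺ x≤k)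

∈-initial⁻ : x ∈ₛ initial k → val x ≤ k
∈-initial⁻ {x = zero}  {k = suc k} here        = s≤s z≤n
∈-initial⁻ {x = suc x} {k = suc k} (there x∈) = s≤s (∈-initial⁻ x∈)
∈-initial⁻ {x = suc x} {k = zero}  (there x∈) with ∈-initial⁻ x∈
... | ()

∣initial∣ : k ≤ m → ∣ initial {m} k ∣ ≡ k
∣initial∣ {m = zero}  z≤n       = refl
∣initial∣ {m = suc m} z≤n       = ∣initial∣ {m = m} z≤n
∣initial∣ {m = suc m} (s≤s k≤m) = cong suc (∣initial∣ k≤m)

initialIn? : (k : ℕ) (B : Subset m) → Dec (InitialIn k B)
initialIn? k B = all? λ x → (val x ≤? k) →-dec (x ∈? B)

¬InitialIn⇒gap : (B : Subset m) → ¬ InitialIn k B → ∃ λ x → val x ≤ k × x ∉ₛ B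
¬InitialIn⇒gap {m} {k} B ¬[k]⊆B with ¬∀⟶∃¬ m _ (λ x → (val x ≤? k) →-dec (x ∈? B)) ¬[k]⊆B
... | x , ¬[x≤k→x∈B] with val x ≤? k | x ∈? B
...   | yes x≤k | no x∉B = x , x≤k , x∉B
...   | yes _   | yes x∈B = contradiction (λ _ → x∈B) ¬[x≤k→x∈B]
...   | no x≰k  | _       = contradiction (λ x≤k → contradiction x≤k x≰k) ¬[x≤k→x∈B]

val-fromℕ : ∀ m → val (fromℕ m) ≡ suc m
val-fromℕ m = cong suc (toℕ-fromℕ m)

≢fromℕ⇒val≤ : (x : Fin (suc m)) → x ≢ fromℕ m → val x ≤ m
≢fromℕ⇒val≤ {zero}  zero    x≢fromℕ = contradiction refl x≢fromℕ
≢fromℕ⇒val≤ {suc m} zero    _       = s≤s z≤n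
≢fromℕ⇒val≤ {suc m} (suc x) x≢fromℕ = s≤s (≢fromℕ⇒val≤ x (x≢fromℕ ∘ cong suc))

-- Lists of k-subsets

choose : Subset m → ℕ → List (Subset m)
choose []            zero    = [] ∷ []
choose []            (suc k) = []
choose (outside ∷ q) k       = map (outside ∷_) (choose q k)
choose (inside ∷ q)  zero    = map (outside ∷_) (choose q zero)
choose (inside ∷ q)  (suc k) = map (outside ∷_) (choose q (suc k)) ++ map (inside ∷_) (choose q k)

length-choose : (q : Subset m) (k : ℕ) → length (choose q k) ≡ ∣ q ∣ C k
length-choose []            zero    = refl
length-choose []            (suc k) = refl
length-choose (outside ∷ q) k       = trans (length-map _ (choose q k)) (length-choose q k)
length-choose (inside ∷ q)  zero    = trans (length-map _ (choose q zero)) (length-choose q zero)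
length-choose (inside ∷ q)  (suc k) = begin
  length (map (outside ∷_) (choose q (suc k)) ++ map (inside ∷_) (choose q k))
    ≡⟨ length-++ (map (outside ∷_) (choose q (suc k))) ⟩
  length (map (outside ∷_) (choose q (suc k))) + length (map (inside ∷_) (choose q k))
    ≡⟨ cong₂ _+_ (length-map _ (choose q (suc k))) (length-map _ (choose q k)) ⟩
  length (choose q (suc k)) + length (choose q k)
    ≡⟨ cong₂ _+_ (length-choose q (suc k)) (length-choose q k) ⟩
  ∣ q ∣ C suc k + ∣ q ∣ C k
    ≡⟨ +-comm (∣ q ∣ C suc k) (∣ q ∣ C k) ⟩
  ∣ q ∣ C k + ∣ q ∣ C suc k
    ≡⟨ nCk+nC[k+1]≡[n+1]C[k+1] ∣ q ∣ k ⟩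
  suc ∣ q ∣ C suc k ∎
  where open ≡-Reasoning

∈-choose⁺ : (q r : Subset m) → r ⊆ₛ q → ∣ r ∣ ≡ k → r ∈ choose q k
∈-choose⁺ []            []            _   refl = here refl
∈-choose⁺ (outside ∷ q) (inside ∷ r)  r⊆q _    = contradiction (r⊆q here) λ ()
∈-choose⁺ (outside ∷ q) (outside ∷ r) r⊆q ∣r∣≡k = ∈-map⁺ _ (∈-choose⁺ q r (drop-∷-⊆ r⊆q) ∣r∣≡k)
∈-choose⁺ {k = zero}  (inside ∷ q) (outside ∷ r) r⊆q ∣r∣≡0 =
  ∈-map⁺ _ (∈-choose⁺ q r (drop-∷-⊆ r⊆q) ∣r∣≡0)
∈-choose⁺ {k = suc k} (inside ∷ q) (outside ∷ r) r⊆q ∣r∣≡k =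
  ∈-++⁺ˡ (∈-map⁺ _ (∈-choose⁺ q r (drop-∷-⊆ r⊆q) ∣r∣≡k))
∈-choose⁺ {k = suc k} (inside ∷ q) (inside ∷ r)  r⊆q ∣r∣≡k =
  ∈-++⁺ʳ (map (outside ∷_) (choose q (suc k)))
         (∈-map⁺ _ (∈-choose⁺ q r (drop-∷-⊆ r⊆q) (suc-injective ∣r∣≡k)))

∈-choose⁻ : (q : Subset m) (k : ℕ) {r : Subset m} → r ∈ choose q k → r ⊆ₛ q × ∣ r ∣ ≡ k
∈-choose⁻ []            zero    (here refl) = id , refl
∈-choose⁻ (outside ∷ q) k       r∈ with ∈-map⁻ _ r∈
... | _ , r∈′ , refl = let r⊆q , ∣r∣≡k = ∈-choose⁻ q k r∈′ in out⊆ r⊆q , ∣r∣≡k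
∈-choose⁻ (inside ∷ q)  zero    r∈ with ∈-map⁻ _ r∈
... | _ , r∈′ , refl = let r⊆q , ∣r∣≡k = ∈-choose⁻ q zero r∈′ in out⊆ r⊆q , ∣r∣≡k
∈-choose⁻ (inside ∷ q)  (suc k) r∈ with ∈-++⁻ (map (outside ∷_) (choose q (suc k))) r∈
... | inj₁ r∈ˡ with ∈-map⁻ _ r∈ˡ
...   | _ , r∈′ , refl = let r⊆q , ∣r∣≡k = ∈-choose⁻ q (suc k) r∈′ in out⊆ r⊆q , ∣r∣≡k
∈-choose⁻ (inside ∷ q)  (suc k) r∈ | inj₂ r∈ʳ with ∈-map⁻ _ r∈ʳ
...   | _ , r∈′ , refl = let r⊆q , ∣r∣≡k = ∈-choose⁻ q k r∈′ in in⊆in r⊆q , cong suc ∣r∣≡k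

choose-unique : (q : Subset m) (k : ℕ) → Unique (choose q k)
choose-unique []            zero    = [] ∷ []
choose-unique []            (suc k) = []
choose-unique (outside ∷ q) k       = Unique.map⁺ ∷-injectiveʳ (choose-unique q k)
choose-unique (inside ∷ q)  zero    = Unique.map⁺ ∷-injectiveʳ (choose-unique q zero)
choose-unique (inside ∷ q)  (suc k) =
  Unique.++⁺ (Unique.map⁺ ∷-injectiveʳ (choose-unique q (suc k)))
             (Unique.map⁺ ∷-injectiveʳ (choose-unique q k))
             λ (r∈ˡ , r∈ʳ) →
               let _ , _ , r≡outside∷ = ∈-map⁻ _ r∈ˡ
                   _ , _ , r≡inside∷  = ∈-map⁻ _ r∈ʳ
               in  contradiction (trans (sym r≡outside∷) r≡inside∷) λ ()

module _ {A B : Set} (f : A → List B) where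

  length-concatMap : ∀ {c} (xs : List A) → (∀ {x} → x ∈ xs → length (f x) ≡ c) →
                     length (concatMap f xs) ≡ length xs * c
  length-concatMap []       _   = refl
  length-concatMap (x ∷ xs) len =
    trans (length-++ (f x)) (cong₂ _+_ (len (here refl)) (length-concatMap xs (len ∘ there)))

  concatMap-unique : {xs : List A} → Unique xs → (∀ x → Unique (f x)) →
                     (∀ {x y v} → v ∈ f x → v ∈ f y → x ≡ y) → Unique (concatMap f xs)
  concatMap-unique []              _  _         = []
  concatMap-unique {x ∷ xs} (x∉xs ∷ xs!) f! f-disjoint =
    Unique.++⁺ (f! x) (concatMap-unique xs! f! f-disjoint) λ (v∈fx , v∈rest) →
      let y , y∈xs , v∈fy = find (∈-concatMap⁻ f v∈rest)
      in  All.lookup x∉xs y∈xs (f-disjoint v∈fx v∈fy)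

-- Independent sets

Dominates : (n a b : ℕ) → VSet n → VSet n → Set
Dominates n a b R S = ∀ v → IsVertex n a b v → ¬ S v → ∃ λ w → R w × Adj v w

module _ {n a b : ℕ} {R S : VSet n} (S? : ∀ v → Dec (S v)) (dominates : Dominates n a b R S) where

  dominated⇒⊆ : {T : VSet n} → Independent n a b T → R ⊆ᵥ T → T ⊆ᵥ S
  dominated⇒⊆ (T-vertices , T-independent) R⊆T v v∈T with S? v
  ... | yes v∈S = v∈S
  ... | no  v∉S =
    let w , w∈R , v~w = dominates v (T-vertices v v∈T) v∉S
    in  contradiction v~w (T-independent v w v∈T (R⊆T w w∈R))

  maximal-if-dominates : Independent n a b S → R ⊆ᵥ S → MaximalIndependent n a b S
  maximal-if-dominates S-independent R⊆S =
    S-independent , λ T T-independent S⊆T → dominated⇒⊆ T-independent λ v → S⊆T v ∘ R⊆S v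

isVertex? : (a b : ℕ) (v : Vtx m) → Dec (IsVertex m a b v)
isVertex? a b (A , B) = A ⊆? B ×-dec ∣ A ∣ ≟ a ×-dec ∣ B ∣ ≟ b

condI? : (n i : ℕ) (v : Vtx n) → Dec (CondI n i v)
condI? n i (_ , B) = initialIn? i B ×-dec all? λ x → (x ∈? B) →-dec (val x ≤? n ∸ 1)

condII? : (n i : ℕ) (v : Vtx n) → Dec (CondII n i v)
condII? n i (A , B) = any? λ x →
  ((x ∈? A) ×-dec all? λ y → (y ∈? A) →-dec (val x ≤? val y)) ×-dec (val x ≤? i) ×-dec initialIn? (val x) B

𝓕? : (n a b i : ℕ) (v : Vtx n) → Dec (𝓕 n a b i v)
𝓕? n a b i v = isVertex? a b v ×-dec (condI? n i v ⊎-dec condII? n i v)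

𝓕̄? : (n a b i : ℕ) (v : Vtx n) → Dec (𝓕̄ n a b i v)
𝓕̄? n a b i v = isVertex? a b v ×-dec (initialIn? i (proj₂ v) ⊎-dec condII? n i v)

-- Adjacency of flags

genPos⇒∩≡⊥ : {p q : Subset m} → ∣ p ∣ + ∣ q ∣ < m → GenPos p q → p ∩ q ≡ ⊥
genPos⇒∩≡⊥         _     (inj₂ p∩q≡⊥) = p∩q≡⊥
genPos⇒∩≡⊥ {m} {p} {q} small (inj₁ p∪q≡⊤) =
  contradiction (subst (_≤ ∣ p ∣ + ∣ q ∣) (trans (cong ∣_∣ p∪q≡⊤) (∣⊤∣≡n m)) (∣p∪q∣≤∣p∣+∣q∣ p q)) (<⇒≱ small)

genPos⇒∪≡⊤ : {p q : Subset m} → m < ∣ p ∣ + ∣ q ∣ → GenPos p q → p ∪ q ≡ ⊤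
genPos⇒∪≡⊤         _     (inj₁ p∪q≡⊤) = p∪q≡⊤
genPos⇒∪≡⊤ {m} {p} {q} large (inj₂ p∩q≡⊥) = contradiction (∣p∣≤n (p ∪ q)) (<⇒≱ (subst (m <_) ∣p∣+∣q∣≡∣p∪q∣ large))
  where
  ∣p∣+∣q∣≡∣p∪q∣ : ∣ p ∣ + ∣ q ∣ ≡ ∣ p ∪ q ∣
  ∣p∣+∣q∣≡∣p∪q∣ = begin
    ∣ p ∣ + ∣ q ∣             ≡⟨ ∣p∪q∣+∣p∩q∣≡∣p∣+∣q∣ p q ⟨
    ∣ p ∪ q ∣ + ∣ p ∩ q ∣     ≡⟨ cong (λ r → ∣ p ∪ q ∣ + ∣ r ∣) p∩q≡⊥ ⟩
    ∣ p ∪ q ∣ + ∣ ⊥ {n = m} ∣ ≡⟨ cong (∣ p ∪ q ∣ +_) (∣⊥∣≡0 m) ⟩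
    ∣ p ∪ q ∣ + 0             ≡⟨ +-identityʳ _ ⟩
    ∣ p ∪ q ∣                 ∎
    where open ≡-Reasoning

Apart : Vtx m → Vtx m → Set
Apart (A , B) (A′ , B′) =
  (∀ {x} → x ∈ₛ A → x ∉ₛ B′) × (∀ {x} → x ∈ₛ A′ → x ∉ₛ B) × (∀ x → x ∈ₛ B ⊎ x ∈ₛ B′)

Apart-sym : {v w : Vtx m} → Apart v w → Apart w v
Apart-sym {v = _ , _} {w = _ , _} (A#B′ , A′#B , cover) = A′#B , A#B′ , swap ∘ cover

Apart⇒Adj : {A B A′ B′ : Subset m} → A ⊆ₛ B → Apart (A , B) (A′ , B′) → Adj (A , B) (A′ , B′)
Apart⇒Adj A⊆B (A#B′ , A′#B , cover) =
  inj₂ (disjoint⇒∩≡⊥ λ x∈A x∈A′ → A′#B x∈A′ (A⊆B x∈A)) ,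
  inj₂ (disjoint⇒∩≡⊥ A#B′) ,
  inj₂ (disjoint⇒∩≡⊥ λ x∈B x∈A′ → A′#B x∈A′ x∈B) ,
  inj₁ (covering⇒∪≡⊤ cover)

Adj⇒Apart : ∀ {a b} {v w : Vtx m} → a + b < m → m < b + b →
            IsVertex m a b v → IsVertex m a b w → Adj v w → Apart v w
Adj⇒Apart {m} {a} {b} {A , B} {A′ , B′} a+b<m m<b+b
          (_ , ∣A∣≡a , ∣B∣≡b) (_ , ∣A′∣≡a , ∣B′∣≡b) (_ , A∘B′ , B∘A′ , B∘B′) =
  ∩≡⊥⇒disjoint (genPos⇒∩≡⊥ (subst (_< m) (sym (cong₂ _+_ ∣A∣≡a ∣B′∣≡b)) a+b<m) A∘B′) ,
  (λ x∈A′ x∈B → ∩≡⊥⇒disjoint (genPos⇒∩≡⊥ ∣B∣+∣A′∣<m B∘A′) x∈B x∈A′) ,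
  ∪≡⊤⇒covering (genPos⇒∪≡⊤ (subst (m <_) (sym (cong₂ _+_ ∣B∣≡b ∣B′∣≡b)) m<b+b) B∘B′)
  where
  ∣B∣+∣A′∣<m : ∣ B ∣ + ∣ A′ ∣ < m
  ∣B∣+∣A′∣<m = subst (_< m) (sym (cong₂ _+_ ∣B∣≡b ∣A′∣≡a)) (subst (_< m) (+-comm a b) a+b<m)

module _ {A B A′ B′ : Subset m} (apart : Apart (A , B) (A′ , B′)) where

  CondII⇒¬InitialIn : CondII m i (A , B) → ¬ InitialIn i B′
  CondII⇒¬InitialIn (x , (x∈A , _) , x≤i , _) [i]⊆B′ = proj₁ apart x∈A ([i]⊆B′ x x≤i)

  CondII⇒¬CondII : ∀ {j} → CondII m i (A , B) → ¬ CondII m j (A′ , B′)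
  CondII⇒¬CondII (x , (x∈A , _) , _ , [x]⊆B) (y , (y∈A′ , _) , _ , [y]⊆B′) with ≤-total (val x) (val y)
  ... | inj₁ x≤y = proj₁ apart x∈A ([y]⊆B′ x x≤y)
  ... | inj₂ y≤x = proj₁ (proj₂ apart) y∈A′ ([x]⊆B y y≤x)

  CondII⇒¬𝓕̄ : CondII m i (A , B) → ¬ (InitialIn i B′ ⊎ CondII m i (A′ , B′))
  CondII⇒¬𝓕̄ II = [ CondII⇒¬InitialIn II , CondII⇒¬CondII II ]

Gap : ℕ → Subset m → Subset m → Set
Gap i A B = ∃ λ x → x ∉ₛ B × val x ≤ i × (∀ y → y ∈ₛ A → val x ≤ val y)

gap-or-initial : {A B : Subset m} {μ : Fin m} → IsMin μ A → ¬ CondII m i (A , B) →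
                 Gap i A B ⊎ (InitialIn i B × (∀ y → y ∈ₛ A → i < val y))
gap-or-initial {i = i} {B = B} {μ} (μ∈A , μ≤A) ¬II with val μ ≤? i
... | yes μ≤i with initialIn? (val μ) B
...   | yes [μ]⊆B = contradiction (μ , (μ∈A , μ≤A) , μ≤i , [μ]⊆B) ¬II
...   | no  [μ]⊈B =
  let x , x≤μ , x∉B = ¬InitialIn⇒gap B [μ]⊈B
  in  inj₁ (x , x∉B , ≤-trans x≤μ μ≤i , λ y y∈A → ≤-trans x≤μ (μ≤A y y∈A))
gap-or-initial {i = i} {B = B} {μ} (μ∈A , μ≤A) ¬II | no μ≰i with initialIn? i B
... | yes [i]⊆B = inj₂ ([i]⊆B , λ y y∈A → <-≤-trans (≰⇒> μ≰i) (μ≤A y y∈A))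
... | no  [i]⊈B =
  let x , x≤i , x∉B = ¬InitialIn⇒gap B [i]⊈B
  in  inj₁ (x , x∉B , x≤i , λ y y∈A → ≤-trans x≤i (<⇒≤ (<-≤-trans (≰⇒> μ≰i) (μ≤A y y∈A))))

[t+t]C[1+t]≡[t+t]C[t∸1] : ∀ t → 1 ≤ t → (t + t) C suc t ≡ (t + t) C (t ∸ 1)
[t+t]C[1+t]≡[t+t]C[t∸1] (suc u) _ =
  trans (nCk≡nC[n∸k] (s≤s (m≤n+m (suc u) u))) (cong ((suc u + suc u) C_) (m+n∸n≡m u (suc u)))

2*[1+t]∸2≡t+t : ∀ t → 2 * suc t ∸ 2 ≡ t + t
2*[1+t]∸2≡t+t t = trans (cong (_∸ 1) (+-suc t (t + 0))) (cong (t +_) (+-identityʳ t))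

-- Flags of type {a, b} in [n], written with n = s + b and b = s + d, where s = n − b and d = 2b − n;
-- taking s = suc t makes n a successor, so that n itself is the element `last` of [n].
module Flags (t d a : ℕ) (1≤a : 1 ≤ a) (a<s : a < suc t) (1≤d : 1 ≤ d) where

  s : ℕ
  s = suc t

  b : ℕ
  b = s + d

  n : ℕ
  n = s + b

  i₀ : ℕ
  i₀ = suc d

  last : Fin n
  last = fromℕ (t + b)

  val-last : val last ≡ n
  val-last = val-fromℕ (t + b)

  i₀<n : i₀ < n
  i₀<n = subst (i₀ <_) (sym (n≡2+d+[t+t] t d)) (s≤s (m≤m+n i₀ (t + t)))
    where
    n≡2+d+[t+t] : ∀ t d → suc t + (suc t + d) ≡ suc (suc d) + (t + t)
    n≡2+d+[t+t] = solve-∀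

  d<n : d < n
  d<n = <⇒≤ i₀<n

  last∉⇒bounded : {B : Subset n} → last ∉ₛ B → ∀ x → x ∈ₛ B → val x ≤ n ∸ 1
  last∉⇒bounded {B} last∉B x x∈B = ≢fromℕ⇒val≤ x λ x≡last → last∉B (subst (_∈ₛ B) x≡last x∈B)

  bounded⇒last∉ : {B : Subset n} → (∀ x → x ∈ₛ B → val x ≤ n ∸ 1) → last ∉ₛ B
  bounded⇒last∉ bounded last∈B = 1+n≰n (subst (_≤ n ∸ 1) val-last (bounded last last∈B))

  adj⇒apart : {v w : Vtx n} → IsVertex n a b v → IsVertex n a b w → Adj v w → Apart v w
  adj⇒apart = Adj⇒Apart (+-monoˡ-< b a<s) (+-monoˡ-< b (m<m+n s 1≤d))

  𝓕-independent : ∀ i → Independent n a b (𝓕 n a b i)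
  𝓕-independent i = (λ _ → proj₁) , λ _ _ (v-vertex , v∈) (w-vertex , w∈) v~w →
    excluded (adj⇒apart v-vertex w-vertex v~w) v∈ w∈
    where
    excluded : {A B A′ B′ : Subset n} → Apart (A , B) (A′ , B′) →
      CondI n i (A , B) ⊎ CondII n i (A , B) → ¬ (CondI n i (A′ , B′) ⊎ CondII n i (A′ , B′))
    excluded apart (inj₂ II) w∈ = CondII⇒¬𝓕̄ apart II (map₁ proj₁ w∈)
    excluded apart (inj₁ I)  (inj₂ II) = CondII⇒¬𝓕̄ (Apart-sym apart) II (inj₁ (proj₁ I))
    excluded (_ , _ , cover) (inj₁ (_ , bounded)) (inj₁ (_ , bounded′)) =
      [ bounded⇒last∉ bounded , bounded⇒last∉ bounded′ ] (cover last)

  apart⇒¬two-initial : {A B A′ B′ : Subset n} → IsVertex n a b (A , B) → IsVertex n a b (A′ , B′) →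
    Apart (A , B) (A′ , B′) → InitialIn i₀ B → ¬ InitialIn i₀ B′
  apart⇒¬two-initial {B = B} {B′ = B′} (_ , _ , ∣B∣≡b) (_ , _ , ∣B′∣≡b) (_ , _ , cover) [i₀]⊆B [i₀]⊆B′ =
    1+n≰n (subst (i₀ ≤_) ∣B∩B′∣≡d (subst (_≤ ∣ B ∩ B′ ∣) (∣initial∣ d<n) (p⊆q⇒∣p∣≤∣q∣ [i₀]⊆B∩B′)))
    where
    [i₀]⊆B∩B′ : initial i₀ ⊆ₛ B ∩ B′
    [i₀]⊆B∩B′ {x} x∈ = x∈p∩q⁺ ([i₀]⊆B x (∈-initial⁻ x∈) , [i₀]⊆B′ x (∈-initial⁻ x∈))
    n+d≡b+b : ∀ s d → s + (s + d) + d ≡ (s + d) + (s + d)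
    n+d≡b+b = solve-∀
    ∣B∩B′∣≡d : ∣ B ∩ B′ ∣ ≡ d
    ∣B∩B′∣≡d = +-cancelˡ-≡ n _ _ (begin
      n + ∣ B ∩ B′ ∣         ≡⟨ cong (_+ ∣ B ∩ B′ ∣) (trans (cong ∣_∣ (covering⇒∪≡⊤ cover)) (∣⊤∣≡n n)) ⟨
      ∣ B ∪ B′ ∣ + ∣ B ∩ B′ ∣ ≡⟨ ∣p∪q∣+∣p∩q∣≡∣p∣+∣q∣ B B′ ⟩
      ∣ B ∣ + ∣ B′ ∣         ≡⟨ cong₂ _+_ ∣B∣≡b ∣B′∣≡b ⟩
      b + b                 ≡⟨ n+d≡b+b s d ⟨
      n + d                 ∎)
      where open ≡-Reasoning

  𝓕̄-independent : Independent n a b (𝓕̄ n a b i₀)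
  𝓕̄-independent = (λ _ → proj₁) , λ _ _ (v-vertex , v∈) (w-vertex , w∈) v~w →
    excluded v-vertex w-vertex (adj⇒apart v-vertex w-vertex v~w) v∈ w∈
    where
    excluded : {A B A′ B′ : Subset n} → IsVertex n a b (A , B) → IsVertex n a b (A′ , B′) →
      Apart (A , B) (A′ , B′) → InitialIn i₀ B ⊎ CondII n i₀ (A , B) → ¬ (InitialIn i₀ B′ ⊎ CondII n i₀ (A′ , B′))
    excluded _ _ apart (inj₂ II) w∈ = CondII⇒¬𝓕̄ apart II w∈
    excluded _ _ apart (inj₁ [i₀]⊆B) (inj₂ II) = CondII⇒¬𝓕̄ (Apart-sym apart) II (inj₁ [i₀]⊆B)
    excluded v-vertex w-vertex apart (inj₁ [i₀]⊆B) (inj₁ [i₀]⊆B′) =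
      apart⇒¬two-initial v-vertex w-vertex apart [i₀]⊆B [i₀]⊆B′

  ∣∁B∣≡s : (B : Subset n) → ∣ B ∣ ≡ b → ∣ ∁ B ∣ ≡ s
  ∣∁B∣≡s B ∣B∣≡b = trans (∣∁p∣≡n∸∣p∣ B) (trans (cong (n ∸_) ∣B∣≡b) (m+n∸n≡m s b))

  ∣∁Z∣≡b : (Z : Subset n) → ∣ Z ∣ ≡ s → ∣ ∁ Z ∣ ≡ b
  ∣∁Z∣≡b Z ∣Z∣≡s = trans (∣∁p∣≡n∸∣p∣ Z) (trans (cong (n ∸_) ∣Z∣≡s) (m+n∸m≡n s b))

  record Neighbour (A B : Subset n) (k : ℕ) (X Y : Subset n) : Set where
    field
      A′ B′    : Subset n
      vertex   : IsVertex n a b (A′ , B′)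
      adjacent : Adj (A , B) (A′ , B′)
      Y⊆A′     : Y ⊆ₛ A′
      A′⊆∁B    : A′ ⊆ₛ ∁ B
      ∁B⊆B′    : ∁ B ⊆ₛ B′
      [k]⊆B′   : InitialIn k B′
      X#B′     : ∀ {x} → x ∈ₛ X → x ∉ₛ B′

  -- The neighbour is (A′ , ∁ Z) with Y ⊆ A′ ⊆ ∁ B and X ⊆ Z ⊆ B ∖ [k]; the sizes fit because
  -- ∣ ∁ B ∣ = s > a and ∣ B ∖ [k] ∣ = b − k ≥ s.
  neighbour : {A B X Y : Subset n} {k : ℕ} → IsVertex n a b (A , B) → k ≤ d → InitialIn k B →
    A ⊆ₛ X → X ⊆ₛ B ─ initial k → ∣ X ∣ ≤ s → Y ⊆ₛ ∁ B → ∣ Y ∣ ≤ a → Neighbour A B k X Y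
  neighbour {A} {B} {X} {Y} {k} (A⊆B , _ , ∣B∣≡b) k≤d [k]⊆B A⊆X X⊆B∖[k] ∣X∣≤s Y⊆∁B ∣Y∣≤a
    with between Y (∁ B) Y⊆∁B ∣Y∣≤a (subst (a ≤_) (sym (∣∁B∣≡s B ∣B∣≡b)) (<⇒≤ a<s))
       | between X (B ─ initial k) X⊆B∖[k] ∣X∣≤s s≤∣B∖[k]∣
    where
    s≤∣B∖[k]∣ : s ≤ ∣ B ─ initial k ∣
    s≤∣B∖[k]∣ = +-cancelʳ-≤ k s ∣ B ─ initial k ∣ (begin
      s + k                         ≤⟨ +-monoʳ-≤ s k≤d ⟩
      b                             ≡⟨ ∣B∣≡b ⟨
      ∣ B ∣                         ≡⟨ ∣p─q∣+∣q∣≡∣p∣ B (initial k) (λ {x} x∈ → [k]⊆B x (∈-initial⁻ x∈)) ⟨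
      ∣ B ─ initial k ∣ + ∣ initial {n} k ∣ ≡⟨ cong (∣ B ─ initial k ∣ +_) (∣initial∣ (≤-trans k≤d (<⇒≤ d<n))) ⟩
      ∣ B ─ initial k ∣ + k         ∎)
      where open ≤-Reasoning
  ... | A′ , Y⊆A′ , A′⊆∁B , ∣A′∣≡a | Z , X⊆Z , Z⊆B∖[k] , ∣Z∣≡s = record
    { A′       = A′
    ; B′       = ∁ Z
    ; vertex   = ∁B⊆∁Z ∘ A′⊆∁B , ∣A′∣≡a , ∣∁Z∣≡b Z ∣Z∣≡s
    ; adjacent = Apart⇒Adj A⊆B (x∈p⇒x∉∁p ∘ X⊆Z ∘ A⊆X , x∈∁p⇒x∉p ∘ A′⊆∁B , cover)
    ; Y⊆A′     = Y⊆A′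
    ; A′⊆∁B    = A′⊆∁B
    ; ∁B⊆B′    = ∁B⊆∁Z
    ; [k]⊆B′   = λ x x≤k → x∉p⇒x∈∁p λ x∈Z → x∈p─q⇒x∉q B (initial k) (Z⊆B∖[k] x∈Z) (∈-initial⁺ x≤k)
    ; X#B′     = x∈p⇒x∉∁p ∘ X⊆Z
    }
    where
    ∁B⊆∁Z : ∁ B ⊆ₛ ∁ Z
    ∁B⊆∁Z = p⊆q⇒∁p⊇∁q (p─q⊆p B (initial k) ∘ Z⊆B∖[k])
    cover : ∀ x → x ∈ₛ B ⊎ x ∈ₛ ∁ Z
    cover x with x ∈? B
    ... | yes x∈B = inj₁ x∈B
    ... | no  x∉B = inj₂ (∁B⊆∁Z (x∉p⇒x∈∁p x∉B))

  neighbour-II : {A B : Subset n} {i : ℕ} → i ≤ i₀ → IsVertex n a b (A , B) → Gap i A B →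
                 ∃ λ w → 𝓕 n a b i w × Adj (A , B) w
  neighbour-II {A} {B} {i} i≤i₀ v-vertex@(A⊆B , ∣A∣≡a , _) (x , x∉B , x≤i , x≤A)
    with minimum (∁ B) (x , x∉p⇒x∈∁p x∉B)
  ... | p , p∈∁B , p≤∁B =
    (A′ , B′) , (vertex , inj₂ (p , (Y⊆A′ (x∈⁅x⁆ p) , p≤A′) , ≤-trans p≤x x≤i , [p]⊆B′)) , adjacent
    where
    p≤x : val p ≤ val x
    p≤x = p≤∁B x (x∉p⇒x∈∁p x∉B)
    [<p]⊆B : InitialIn (toℕ p) B
    [<p]⊆B y y<p with y ∈? B
    ... | yes y∈B = y∈B
    ... | no  y∉B = contradiction (p≤∁B y (x∉p⇒x∈∁p y∉B)) (<⇒≱ (s≤s y<p))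
    A⊆B∖[<p] : A ⊆ₛ B ─ initial (toℕ p)
    A⊆B∖[<p] {y} y∈A = x∈p∧x∉q⇒x∈p─q (A⊆B y∈A) (<⇒≱ (≤-trans p≤x (x≤A y y∈A)) ∘ ∈-initial⁻)
    open Neighbour (neighbour v-vertex (≤-pred (≤-trans p≤x (≤-trans x≤i i≤i₀))) [<p]⊆B id A⊆B∖[<p]
      (subst (_≤ s) (sym ∣A∣≡a) (<⇒≤ a<s))
      (λ y∈⁅p⁆ → subst (_∈ₛ ∁ B) (sym (x∈⁅y⁆⇒x≡y p y∈⁅p⁆)) p∈∁B)
      (subst (_≤ a) (sym (∣⁅x⁆∣≡1 p)) 1≤a))
    p≤A′ : ∀ y → y ∈ₛ A′ → val p ≤ val y
    p≤A′ y y∈A′ = p≤∁B y (A′⊆∁B y∈A′)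
    [p]⊆B′ : InitialIn (val p) B′
    [p]⊆B′ y y≤p with val y ≤? toℕ p
    ... | yes y<p = [k]⊆B′ y y<p
    ... | no  y≮p = subst (_∈ₛ B′) (sym y≡p) (∁B⊆B′ p∈∁B)
      where
      y≡p : y ≡ p
      y≡p = toℕ-injective (suc-injective (≤-antisym y≤p (≰⇒> y≮p)))

  neighbour-I : {A B : Subset n} {i : ℕ} → i ≤ d → IsVertex n a b (A , B) → InitialIn i B → last ∈ₛ B →
                (∀ y → y ∈ₛ A → i < val y) → ∃ λ w → 𝓕 n a b i w × Adj (A , B) w
  neighbour-I {A} {B} {i} i≤d v-vertex@(A⊆B , ∣A∣≡a , _) [i]⊆B last∈B i<A =
    (A′ , B′) , (vertex , inj₁ ([k]⊆B′ , last∉⇒bounded (X#B′ (x∈p∪q⁺ (inj₂ (x∈⁅x⁆ last)))))) , adjacent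
    where
    i<last : i < val last
    i<last = subst (i <_) (sym val-last) (≤-<-trans i≤d d<n)
    X⊆B∖[i] : A ∪ ⁅ last ⁆ ⊆ₛ B ─ initial i
    X⊆B∖[i] {y} y∈X with x∈p∪q⁻ A ⁅ last ⁆ y∈X
    ... | inj₁ y∈A     = x∈p∧x∉q⇒x∈p─q (A⊆B y∈A) (<⇒≱ (i<A y y∈A) ∘ ∈-initial⁻)
    ... | inj₂ y∈⁅last⁆ rewrite x∈⁅y⁆⇒x≡y last y∈⁅last⁆ = x∈p∧x∉q⇒x∈p─q last∈B (<⇒≱ i<last ∘ ∈-initial⁻)
    ∣X∣≤s : ∣ A ∪ ⁅ last ⁆ ∣ ≤ s
    ∣X∣≤s = begin
      ∣ A ∪ ⁅ last ⁆ ∣       ≤⟨ ∣p∪q∣≤∣p∣+∣q∣ A ⁅ last ⁆ ⟩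
      ∣ A ∣ + ∣ ⁅ last ⁆ ∣   ≡⟨ cong₂ _+_ ∣A∣≡a (∣⁅x⁆∣≡1 last) ⟩
      a + 1                 ≡⟨ +-comm a 1 ⟩
      suc a                 ≤⟨ a<s ⟩
      s                     ∎
      where open ≤-Reasoning
    open Neighbour (neighbour v-vertex i≤d [i]⊆B (p⊆p∪q ⁅ last ⁆) X⊆B∖[i] ∣X∣≤s ⊥⊆
      (subst (_≤ a) (sym (∣⊥∣≡0 n)) z≤n))

  nonempty-min : {A B : Subset n} → IsVertex n a b (A , B) → ∃ λ μ → IsMin μ A
  nonempty-min {A} (_ , ∣A∣≡a , _) = minimum A (1≤∣p∣⇒Nonempty A (subst (1 ≤_) (sym ∣A∣≡a) 1≤a))

  𝓕-dominates : ∀ {i} → i ≤ d → Dominates n a b (𝓕 n a b i) (𝓕 n a b i)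
  𝓕-dominates i≤d (A , B) v-vertex v∉𝓕
    with gap-or-initial (proj₂ (nonempty-min v-vertex)) (v∉𝓕 ∘ (v-vertex ,_) ∘ inj₂)
  ... | inj₁ gap = neighbour-II (≤-trans i≤d (n≤1+n d)) v-vertex gap
  ... | inj₂ ([i]⊆B , i<A) with last ∈? B
  ...   | yes last∈B = neighbour-I i≤d v-vertex [i]⊆B last∈B i<A
  ...   | no  last∉B = contradiction (v-vertex , inj₁ ([i]⊆B , last∉⇒bounded last∉B)) v∉𝓕

  𝓕̄-dominates : Dominates n a b (𝓕 n a b i₀) (𝓕̄ n a b i₀)
  𝓕̄-dominates (A , B) v-vertex v∉𝓕̄
    with gap-or-initial (proj₂ (nonempty-min v-vertex)) (v∉𝓕̄ ∘ (v-vertex ,_) ∘ inj₂)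
  ... | inj₁ gap            = neighbour-II ≤-refl v-vertex gap
  ... | inj₂ ([i₀]⊆B , _) = contradiction (v-vertex , inj₁ [i₀]⊆B) v∉𝓕̄

  𝓕⊆𝓕̄ : ∀ {i} → 𝓕 n a b i ⊆ᵥ 𝓕̄ n a b i
  𝓕⊆𝓕̄ _ (v-vertex , I⊎II) = v-vertex , map₁ proj₁ I⊎II

  𝓕-maximal : ∀ {i} → i ≤ d → MaximalIndependent n a b (𝓕 n a b i)
  𝓕-maximal i≤d = maximal-if-dominates (𝓕? n a b _) (𝓕-dominates i≤d) (𝓕-independent _) λ _ → id

  𝓕̄-maximal : MaximalIndependent n a b (𝓕̄ n a b i₀)
  𝓕̄-maximal = maximal-if-dominates (𝓕̄? n a b i₀) 𝓕̄-dominates 𝓕̄-independent 𝓕⊆𝓕̄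

  𝓕̄-unique : (T : VSet n) → MaximalIndependent n a b T → 𝓕 n a b i₀ ⊆ᵥ T →
             (T ⊆ᵥ 𝓕̄ n a b i₀) × (𝓕̄ n a b i₀ ⊆ᵥ T)
  𝓕̄-unique T (T-independent , T-maximal) 𝓕⊆T = T⊆𝓕̄ , T-maximal _ (proj₁ 𝓕̄-maximal) T⊆𝓕̄
    where
    T⊆𝓕̄ : T ⊆ᵥ 𝓕̄ n a b i₀
    T⊆𝓕̄ = dominated⇒⊆ (𝓕̄? n a b i₀) 𝓕̄-dominates T-independent 𝓕⊆T

  -- Counting 𝓕̄ ∖ 𝓕

  upper : Subset n
  upper = ⊤ ─ initial i₀

  inner : Subset n
  inner = upper ─ ⁅ last ⁆

  block : Subset n → List (Vtx n)
  block Z = map (_, ∁ Z) (choose (upper ─ Z) a)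

  surplus : List (Vtx n)
  surplus = concatMap block (choose inner s)

  ≤i₀⇒∉upper : ∀ {x} → val x ≤ i₀ → x ∉ₛ upper
  ≤i₀⇒∉upper x≤i₀ x∈upper = x∈p─q⇒x∉q ⊤ (initial i₀) x∈upper (∈-initial⁺ x≤i₀)

  last∈upper : last ∈ₛ upper
  last∈upper = x∈p∧x∉q⇒x∈p─q ∈⊤ λ last∈[i₀] →
    <⇒≱ (subst (i₀ <_) (sym val-last) i₀<n) (∈-initial⁻ last∈[i₀])

  last∉inner : last ∉ₛ inner
  last∉inner last∈inner = x∈p─q⇒x∉q upper ⁅ last ⁆ last∈inner (x∈⁅x⁆ last)

  ∣upper∣≡s+t : ∣ upper ∣ ≡ s + t
  ∣upper∣≡s+t = +-cancelʳ-≡ i₀ ∣ upper ∣ (s + t) (begin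
    ∣ upper ∣ + i₀                  ≡⟨ cong (∣ upper ∣ +_) (∣initial∣ (<⇒≤ i₀<n)) ⟨
    ∣ upper ∣ + ∣ initial {n} i₀ ∣  ≡⟨ ∣p─q∣+∣q∣≡∣p∣ (⊤ {n}) (initial i₀) ⊆⊤ ⟩
    ∣ ⊤ {n} ∣                      ≡⟨ ∣⊤∣≡n n ⟩
    n                              ≡⟨ n≡s+t+i₀ t d ⟩
    s + t + i₀                     ∎)
    where
    open ≡-Reasoning
    n≡s+t+i₀ : ∀ t d → suc t + (suc t + d) ≡ suc t + t + suc d
    n≡s+t+i₀ = solve-∀

  ∣inner∣≡t+t : ∣ inner ∣ ≡ t + t
  ∣inner∣≡t+t = +-cancelʳ-≡ 1 ∣ inner ∣ (t + t) (begin
    ∣ inner ∣ + 1               ≡⟨ cong (∣ inner ∣ +_) (∣⁅x⁆∣≡1 last) ⟨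
    ∣ inner ∣ + ∣ ⁅ last ⁆ ∣    ≡⟨ ∣p─q∣+∣q∣≡∣p∣ upper ⁅ last ⁆ ⁅last⁆⊆upper ⟩
    ∣ upper ∣                  ≡⟨ ∣upper∣≡s+t ⟩
    suc t + t                  ≡⟨ +-comm 1 (t + t) ⟩
    t + t + 1                  ∎)
    where
    open ≡-Reasoning
    ⁅last⁆⊆upper : ⁅ last ⁆ ⊆ₛ upper
    ⁅last⁆⊆upper x∈ = subst (_∈ₛ upper) (sym (x∈⁅y⁆⇒x≡y last x∈)) last∈upper

  ∣upper∖Z∣≡t : {Z : Subset n} → Z ⊆ₛ upper → ∣ Z ∣ ≡ s → ∣ upper ─ Z ∣ ≡ t
  ∣upper∖Z∣≡t {Z} Z⊆upper ∣Z∣≡s = +-cancelʳ-≡ s ∣ upper ─ Z ∣ t (begin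
    ∣ upper ─ Z ∣ + s          ≡⟨ cong (∣ upper ─ Z ∣ +_) ∣Z∣≡s ⟨
    ∣ upper ─ Z ∣ + ∣ Z ∣      ≡⟨ ∣p─q∣+∣q∣≡∣p∣ upper Z Z⊆upper ⟩
    ∣ upper ∣                 ≡⟨ ∣upper∣≡s+t ⟩
    s + t                     ≡⟨ +-comm s t ⟩
    t + s                     ∎)
    where open ≡-Reasoning

  length-surplus : length surplus ≡ ((2 * s ∸ 2) C (s ∸ 2)) * ((s ∸ 1) C a)
  length-surplus = begin
    length surplus                       ≡⟨ length-concatMap block (choose inner s) length-block ⟩
    length (choose inner s) * (t C a)     ≡⟨ cong (_* (t C a)) (length-choose inner s) ⟩
    (∣ inner ∣ C s) * (t C a)             ≡⟨ cong (λ k → (k C s) * (t C a)) ∣inner∣≡t+t ⟩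
    ((t + t) C s) * (t C a)              ≡⟨ cong (_* (t C a)) ([t+t]C[1+t]≡[t+t]C[t∸1] t 1≤t) ⟩
    ((t + t) C (t ∸ 1)) * (t C a)        ≡⟨ cong (λ k → (k C (t ∸ 1)) * (t C a)) (2*[1+t]∸2≡t+t t) ⟨
    ((2 * s ∸ 2) C (s ∸ 2)) * (t C a)    ∎
    where
    open ≡-Reasoning
    1≤t : 1 ≤ t
    1≤t = ≤-pred (≤-trans (s≤s 1≤a) a<s)
    length-block : ∀ {Z} → Z ∈ choose inner s → length (block Z) ≡ t C a
    length-block {Z} Z∈ = let Z⊆inner , ∣Z∣≡s = ∈-choose⁻ inner s Z∈ in begin
      length (block Z)                 ≡⟨ length-map _ (choose (upper ─ Z) a) ⟩
      length (choose (upper ─ Z) a)    ≡⟨ length-choose (upper ─ Z) a ⟩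
      ∣ upper ─ Z ∣ C a                ≡⟨ cong (_C a) (∣upper∖Z∣≡t (p─q⊆p upper ⁅ last ⁆ ∘ Z⊆inner) ∣Z∣≡s) ⟩
      t C a                           ∎

  surplus-unique : Unique surplus
  surplus-unique = concatMap-unique block (choose-unique inner s)
    (λ Z → Unique.map⁺ (cong proj₁) (choose-unique (upper ─ Z) a)) same-block
    where
    same-block : ∀ {Z Z′ v} → v ∈ block Z → v ∈ block Z′ → Z ≡ Z′
    same-block v∈ v∈′ with ∈-map⁻ _ v∈ | ∈-map⁻ _ v∈′
    ... | _ , _ , refl | _ , _ , v≡ = ∁-injective (cong proj₂ v≡)

  surplus-sound : ∀ v → v ∈ surplus → 𝓕̄ n a b i₀ v × ¬ 𝓕 n a b i₀ v
  surplus-sound v v∈ with find (∈-concatMap⁻ block v∈)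
  ... | Z , Z∈ , v∈block with ∈-map⁻ _ v∈block
  ... | A , A∈ , refl =
    ((A⊆∁Z , ∣A∣≡a , ∣∁Z∣≡b Z ∣Z∣≡s) , inj₁ [i₀]⊆∁Z) , λ where
      (_ , inj₁ (_ , bounded))          → bounded⇒last∉ bounded (x∉p⇒x∈∁p (last∉inner ∘ Z⊆inner))
      (_ , inj₂ (μ , (μ∈A , _) , μ≤i₀ , _)) → ≤i₀⇒∉upper μ≤i₀ (p─q⊆p upper Z (A⊆upper∖Z μ∈A))
    where
    Z⊆inner : Z ⊆ₛ inner
    Z⊆inner = proj₁ (∈-choose⁻ inner s Z∈)
    ∣Z∣≡s : ∣ Z ∣ ≡ s
    ∣Z∣≡s = proj₂ (∈-choose⁻ inner s Z∈)
    A⊆upper∖Z : A ⊆ₛ upper ─ Z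
    A⊆upper∖Z = proj₁ (∈-choose⁻ (upper ─ Z) a A∈)
    ∣A∣≡a : ∣ A ∣ ≡ a
    ∣A∣≡a = proj₂ (∈-choose⁻ (upper ─ Z) a A∈)
    A⊆∁Z : A ⊆ₛ ∁ Z
    A⊆∁Z = x∉p⇒x∈∁p ∘ x∈p─q⇒x∉q upper Z ∘ A⊆upper∖Z
    [i₀]⊆∁Z : InitialIn i₀ (∁ Z)
    [i₀]⊆∁Z x x≤i₀ = x∉p⇒x∈∁p (≤i₀⇒∉upper x≤i₀ ∘ p─q⊆p upper ⁅ last ⁆ ∘ Z⊆inner)

  surplus-complete : ∀ v → 𝓕̄ n a b i₀ v × ¬ 𝓕 n a b i₀ v → v ∈ surplus
  surplus-complete _ ((v-vertex , inj₂ II) , v∉𝓕) = contradiction (v-vertex , inj₂ II) v∉𝓕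
  surplus-complete (A , B) ((v-vertex@(A⊆B , ∣A∣≡a , ∣B∣≡b) , inj₁ [i₀]⊆B) , v∉𝓕) =
    subst (_∈ surplus) (cong (A ,_) (∁-involutive B))
      (∈-concatMap⁺ block (lose (∈-choose⁺ inner (∁ B) ∁B⊆inner (∣∁B∣≡s B ∣B∣≡b))
                                (∈-map⁺ _ (∈-choose⁺ (upper ─ ∁ B) A A⊆upper∖∁B ∣A∣≡a))))
    where
    last∈B : last ∈ₛ B
    last∈B with last ∈? B
    ... | yes last∈B = last∈B
    ... | no  last∉B = contradiction (v-vertex , inj₁ ([i₀]⊆B , last∉⇒bounded last∉B)) v∉𝓕
    ∁B⊆inner : ∁ B ⊆ₛ inner
    ∁B⊆inner {x} x∈∁B = x∈p∧x∉q⇒x∈p─q (x∈p∧x∉q⇒x∈p─q ∈⊤ (x∉B ∘ [i₀]⊆B x ∘ ∈-initial⁻))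
      λ x∈⁅last⁆ → x∉B (subst (_∈ₛ B) (sym (x∈⁅y⁆⇒x≡y last x∈⁅last⁆)) last∈B)
      where
      x∉B : x ∉ₛ B
      x∉B = x∈∁p⇒x∉p x∈∁B
    A⊆upper∖∁B : A ⊆ₛ upper ─ ∁ B
    A⊆upper∖∁B {y} y∈A = x∈p∧x∉q⇒x∈p─q (x∈p∧x∉q⇒x∈p─q ∈⊤ y∉[i₀]) (x∈p⇒x∉∁p (A⊆B y∈A))
      where
      y∉[i₀] : y ∉ₛ initial i₀
      y∉[i₀] y∈[i₀] =
        let μ , μ-min = nonempty-min v-vertex
            μ≤i₀     = ≤-trans (proj₂ μ-min y y∈A) (∈-initial⁻ y∈[i₀])
        in  v∉𝓕 (v-vertex , inj₂ (μ , μ-min , μ≤i₀ , λ z z≤μ → [i₀]⊆B z (≤-trans z≤μ μ≤i₀)))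

m<n⇒∃[o]n≡1+o+m : ∀ {m n} → m < n → ∃ λ o → n ≡ suc o + m
m<n⇒∃[o]n≡1+o+m {m} m<n =
  let o , 1+m+o≡n = m≤n⇒∃[o]m+o≡n m<n in o , sym (trans (cong suc (+-comm o m)) 1+m+o≡n)

decompose : {n a b : ℕ} → a + b < n → n < 2 * b →
  ∃₂ λ t d → a < suc t × 1 ≤ d × b ≡ suc t + d × n ≡ suc t + b
decompose {a = a} {b} a+b<n n<2b with m<n⇒∃[o]n≡1+o+m (≤-<-trans (m≤n+m b a) a+b<n)
... | t , refl
  with m<n⇒∃[o]n≡1+o+m (+-cancelʳ-< b (suc t) b (subst (suc t + b <_) (cong (b +_) (+-identityʳ b)) n<2b))
... | e , refl = t , suc e , +-cancelʳ-< _ a (suc t) a+b<n , s≤s z≤n , +-comm (suc e) (suc t) , refl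

2b∸n≡d : ∀ t d → 2 * (suc t + d) ∸ (suc t + (suc t + d)) ≡ d
2b∸n≡d t d = trans (cong (_∸ (suc t + (suc t + d))) (2b≡n+d t d)) (m+n∸m≡n (suc t + (suc t + d)) d)
  where
  2b≡n+d : ∀ t d → 2 * (suc t + d) ≡ suc t + (suc t + d) + d
  2b≡n+d = solve-∀

n∸b≡s : ∀ t d → suc t + (suc t + d) ∸ (suc t + d) ≡ suc t
n∸b≡s t d = m+n∸n≡m (suc t) (suc t + d)

mainTheorem6 : (n a b : ℕ) → 1 ≤ a → 1 ≤ b → a + b < n → n < 2 * b →
    ((i : ℕ) → i ≤ 2 * b ∸ n → MaximalIndependent n a b (𝓕 n a b i))
    × (MaximalIndependent n a b (𝓕̄ n a b (2 * b ∸ n + 1))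
      × 𝓕 n a b (2 * b ∸ n + 1) ⊆ᵥ 𝓕̄ n a b (2 * b ∸ n + 1)
      × ((T : VSet n) → MaximalIndependent n a b T → 𝓕 n a b (2 * b ∸ n + 1) ⊆ᵥ T →
          (T ⊆ᵥ 𝓕̄ n a b (2 * b ∸ n + 1)) × (𝓕̄ n a b (2 * b ∸ n + 1) ⊆ᵥ T))
      × Σ (List (Vtx n)) (λ L → Unique L
          × length L ≡ ((2 * (n ∸ b) ∸ 2) C (n ∸ b ∸ 2)) * ((n ∸ b ∸ 1) C a)
          × ((v : Vtx n) → (v ∈ L) ⇔ (𝓕̄ n a b (2 * b ∸ n + 1) v × ¬ 𝓕 n a b (2 * b ∸ n + 1) v))))
mainTheorem6 n a b 1≤a _ a+b<n n<2b with decompose {n} {a} {b} a+b<n n<2b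
... | t , d , a<s , 1≤d , refl , refl rewrite 2b∸n≡d t d | n∸b≡s t d | +-comm d 1 =
  (λ _ → 𝓕-maximal) , 𝓕̄-maximal , 𝓕⊆𝓕̄ , 𝓕̄-unique ,
  surplus , surplus-unique , length-surplus , λ v → mk⇔ (surplus-sound v) (surplus-complete v)
  where open Flags t d a 1≤a a<s 1≤d
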